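{- $g^3(C_{18})=10$.
   Context: $C_n$ denotes the cyclic group of order $n$. For a finite abelian group $G$ (written additively) and a positive integer $k$, the $k$-Harborth constant $g^k(G)$ is the smallest positive integer $t$ such that every subset $S\subseteq G$ with $|S|\ge t$ contains a subset $T$ with $|T|=k$ and $\sum_{x\in T}x=0$. -}

module Defs where

open import Data.Nat using (ℕ; zero; suc; _+_; _≤_; NonZero)
open import Data.Nat.DivMod using (_%_)
open import Data.Fin using (Fin; toℕ) renaming (zero to fzero; suc to fsuc)
open import Data.Fin.Subset using (Subset; _⊆_; ∣_∣; inside; outside)
open import Data.Vec using (Vec; []; _∷_)
open import Data.Bool using (Bool; true; false)
open import Data.Product using (Σ; _×_; ∃-syntax)
open import Relation.Binary.PropositionalEquality using (_≡_)

-- The cyclic group C_n is modelled as Fin n (elements 0,…,n-1) with addition mod n.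
-- Natural-number sum of the representatives 0..n-1 of the elements of a subset.
subsetSumℕ : ∀ {n} → Subset n → ℕ
subsetSumℕ {n} T = go T (λ i → toℕ i)
  where
  go : ∀ {m} → Subset m → (Fin m → ℕ) → ℕ
  go [] f = 0
  go (outside ∷ T) f = go T (λ i → f (fsuc i))
  go (inside ∷ T) f = f fzero + go T (λ i → f (fsuc i))

ZeroSum : ∀ {n} .{{_ : NonZero n}} → Subset n → Set
ZeroSum {n} T = subsetSumℕ T % n ≡ 0

HasZeroSumSubsetOfSize : (k n : ℕ) .{{_ : NonZero n}} → Subset n → Set
HasZeroSumSubsetOfSize k n S = ∃[ T ] (T ⊆ S × ∣ T ∣ ≡ k × ZeroSum T)

HarborthProperty : (k n : ℕ) .{{_ : NonZero n}} → ℕ → Set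
HarborthProperty k n t = (S : Subset n) → t ≤ ∣ S ∣ → HasZeroSumSubsetOfSize k n S

IsHarborthConstant : (k n : ℕ) .{{_ : NonZero n}} → ℕ → Set
IsHarborthConstant k n t =
  1 ≤ t × HarborthProperty k n t
  × ((t' : ℕ) → 1 ≤ t' → HarborthProperty k n t' → t ≤ t')

{-# OPTIONS --safe #-}
-- Lower bound: the nine odd residues contain no zero-sum triple, as a sum of three odd
-- numbers is odd while 18 is even; this is confirmed by enumerating the subsets of the odd
-- residues. Upper bound: a branch-and-bound search decides membership of 0, 1, …, 17 in turn
-- and closes a branch as soon as the elements chosen so far contain one of the 46 zero-sum
-- 3-subsets of C₁₈, or too few undecided elements remain to reach 10 elements.
module Submission where

open import Defs
open import Data.Bool using (Bool; T; _∨_; _∧_)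
open import Data.Bool.Properties using (T-∨; T-∧)
open import Data.Fin.Subset using (Subset; _⊆_; ∣_∣; inside; outside; ⊥; ⊤)
open import Data.Fin.Subset.Properties using (⊆-min; ⊆-trans; drop-∷-⊆; ∣⊥∣≡0; _⊆?_; anySubset?)
open import Data.List using (List; []; _∷_; _++_; [_]; length; map; upTo)
open import Data.List.Properties using (++-assoc)
open import Data.List.Relation.Unary.All using (All; all?; lookupAny)
open import Data.List.Relation.Unary.Any as Any using (Any; any?)
open import Data.Nat using (ℕ; zero; suc; _+_; _≤_; _<_; _≡ᵇ_; _<?_; _≤?_; _≟_; _+⋎_; NonZero; z≤n; s≤s)
open import Data.Nat.Properties using (≤-trans; m≤n⇒m≤1+n; <⇒≱; ≰⇒>)
open import Data.Product using (∃-syntax; _×_; _,_)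
open import Data.Sum using (_⊎_; inj₁; inj₂)
open import Data.Vec using ([]; _∷_; toList; _⋎_; here; there)
open import Data.Vec.Properties using (length-toList)
open import Function.Bundles using (Equivalence)
open import Relation.Nullary using (¬_; Dec; yes; no; _×-dec_; contradiction)
open import Relation.Nullary.Decidable using (isYes; _⊎-dec_; toWitness; toWitnessFalse)
open import Relation.Unary using (Decidable)
open import Relation.Binary.PropositionalEquality using (_≡_; refl; sym; cong; subst)

fromPrefix : ∀ n → List Bool → Subset n
fromPrefix n [] = ⊥
fromPrefix zero (b ∷ p) = []
fromPrefix (suc n) (b ∷ p) = b ∷ fromPrefix n p

fromPrefix-toList : ∀ {n} (S : Subset n) → fromPrefix n (toList S) ≡ S
fromPrefix-toList [] = refl
fromPrefix-toList (b ∷ S) = cong (b ∷_) (fromPrefix-toList S)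

fromPrefix-⊆-++ : ∀ n p s → fromPrefix n p ⊆ fromPrefix n (p ++ s)
fromPrefix-⊆-++ n [] s = ⊆-min _
fromPrefix-⊆-++ (suc n) (b ∷ p) s here = here
fromPrefix-⊆-++ (suc n) (b ∷ p) s (there x∈p) = there (fromPrefix-⊆-++ n p s x∈p)

∣fromPrefix∣≤length : ∀ n p → ∣ fromPrefix n p ∣ ≤ length p
∣fromPrefix∣≤length n [] rewrite ∣⊥∣≡0 n = z≤n
∣fromPrefix∣≤length zero (b ∷ p) = z≤n
∣fromPrefix∣≤length (suc n) (inside ∷ p) = s≤s (∣fromPrefix∣≤length n p)
∣fromPrefix∣≤length (suc n) (outside ∷ p) = m≤n⇒m≤1+n (∣fromPrefix∣≤length n p)

∣fromPrefix-++∣≤ : ∀ n p s → ∣ fromPrefix n (p ++ s) ∣ ≤ ∣ fromPrefix n p ∣ + length s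
∣fromPrefix-++∣≤ n [] s rewrite ∣⊥∣≡0 n = ∣fromPrefix∣≤length n s
∣fromPrefix-++∣≤ zero (b ∷ p) s = z≤n
∣fromPrefix-++∣≤ (suc n) (inside ∷ p) s = s≤s (∣fromPrefix-++∣≤ n p s)
∣fromPrefix-++∣≤ (suc n) (outside ∷ p) s = ∣fromPrefix-++∣≤ n p s

module ThresholdSearch {n} (Q : Subset n → Set) (Q? : Decidable Q)
                       (Q-mono : ∀ {S S′} → S ⊆ S′ → Q S → Q S′) (t : ℕ) where

  CompletionsSatisfy : ℕ → List Bool → Set
  CompletionsSatisfy m p =
    ∀ s → length s ≡ m → t ≤ ∣ fromPrefix n (p ++ s) ∣ → Q (fromPrefix n (p ++ s))

  Settled : ℕ → List Bool → Set
  Settled m p = ∣ fromPrefix n p ∣ + m < t ⊎ Q (fromPrefix n p)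

  settled? : ∀ m p → Dec (Settled m p)
  settled? m p = ∣ fromPrefix n p ∣ + m <? t ⊎-dec Q? (fromPrefix n p)

  -- A Bool rather than a Dec: normalising a Dec-valued recursion at n = 18 exhausts memory.
  covers : ℕ → List Bool → Bool
  covers zero p = isYes (settled? zero p)
  covers (suc m) p =
    isYes (settled? (suc m) p) ∨ (covers m (p ++ [ outside ]) ∧ covers m (p ++ [ inside ]))

  settled-sound : ∀ {m} p → Settled m p → CompletionsSatisfy m p
  settled-sound p (inj₁ tooSmall) s refl t≤∣S∣ =
    contradiction (≤-trans t≤∣S∣ (∣fromPrefix-++∣≤ n p s)) (<⇒≱ tooSmall)
  settled-sound p (inj₂ q) s refl _ = Q-mono (fromPrefix-⊆-++ n p s) q

  extend-sound : ∀ m p → CompletionsSatisfy m (p ++ [ outside ]) →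
                 CompletionsSatisfy m (p ++ [ inside ]) → CompletionsSatisfy (suc m) p
  extend-sound m p h₀ h₁ (outside ∷ s) refl rewrite sym (++-assoc p [ outside ] s) = h₀ s refl
  extend-sound m p h₀ h₁ (inside ∷ s) refl rewrite sym (++-assoc p [ inside ] s) = h₁ s refl

  covers-sound : ∀ m p → T (covers m p) → CompletionsSatisfy m p
  covers-sound zero p c = settled-sound p (toWitness c)
  covers-sound (suc m) p c with Equivalence.to (T-∨ {isYes (settled? (suc m) p)}) c
  ... | inj₁ s = settled-sound p (toWitness s)
  ... | inj₂ c′ with Equivalence.to (T-∧ {covers m (p ++ [ outside ])}) c′
  ...   | c₀ , c₁ = extend-sound m p (covers-sound m _ c₀) (covers-sound m _ c₁)

  covers-all-large : T (covers n []) → ∀ S → t ≤ ∣ S ∣ → Q S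
  covers-all-large c S t≤∣S∣ =
    subst Q (fromPrefix-toList S)
      (covers-sound n [] c (toList S) (length-toList S)
        (subst (λ X → t ≤ ∣ X ∣) (sym (fromPrefix-toList S)) t≤∣S∣))

ZeroSum? : ∀ {n} .{{_ : NonZero n}} (T : Subset n) → Dec (ZeroSum T)
ZeroSum? T = _ ≟ 0

any-⊆-mono : ∀ {n} (Ts : List (Subset n)) {S S′ : Subset n} → S ⊆ S′ → Any (_⊆ S) Ts → Any (_⊆ S′) Ts
any-⊆-mono Ts {S} {S′} S⊆S′ = Any.map {P = _⊆ S} {Q = _⊆ S′} λ T⊆S → ⊆-trans T⊆S S⊆S′

hasZeroSumSubset-fromCandidates : ∀ {k n} .{{_ : NonZero n}} {Ts : List (Subset n)} {S : Subset n} →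
  All (λ T → ∣ T ∣ ≡ k × ZeroSum T) Ts → Any (_⊆ S) Ts → HasZeroSumSubsetOfSize k n S
hasZeroSumSubset-fromCandidates valid T⊆S with lookupAny valid T⊆S
... | (∣T∣≡k , zeroSum) , T⊆S′ = Any.lookup T⊆S , T⊆S′ , ∣T∣≡k , zeroSum

zeroSumFree⇒size< : ∀ {k n t} .{{_ : NonZero n}} (S : Subset n) →
  ¬ HasZeroSumSubsetOfSize k n S → HarborthProperty k n t → ∣ S ∣ < t
zeroSumFree⇒size< {t = t} S zeroSumFree property with t ≤? ∣ S ∣
... | yes t≤∣S∣ = contradiction (property S t≤∣S∣) zeroSumFree
... | no t≰∣S∣ = ≰⇒> t≰∣S∣

-- ⊥ ⋎ U places the bits of U at the odd positions 1, 3, 5, …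
oddResidues : ∀ n → Subset (n +⋎ n)
oddResidues n = ⊥ {n} ⋎ ⊤

⊆-oddResidues : ∀ n {T : Subset (n +⋎ n)} → T ⊆ oddResidues n → ∃[ U ] T ≡ ⊥ {n} ⋎ U
⊆-oddResidues zero {[]} _ = [] , refl
⊆-oddResidues (suc n) {inside ∷ _} T⊆odd with T⊆odd here
... | ()
⊆-oddResidues (suc n) {outside ∷ b ∷ T} T⊆odd with ⊆-oddResidues n (drop-∷-⊆ (drop-∷-⊆ T⊆odd))
... | U , refl = b ∷ U , refl

oddResidues-zeroSumTripleFree : ¬ HasZeroSumSubsetOfSize 3 18 (oddResidues 9)
oddResidues-zeroSumTripleFree (T , T⊆odd , ∣T∣≡3 , zeroSum) with ⊆-oddResidues 9 T⊆odd
... | U , refl = noneOfSize3ZeroSum (U , ∣T∣≡3 , zeroSum)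
  where
  noneOfSize3ZeroSum : ¬ (∃[ U ] ∣ ⊥ {9} ⋎ U ∣ ≡ 3 × ZeroSum (⊥ {9} ⋎ U))
  noneOfSize3ZeroSum =
    toWitnessFalse {a? = anySubset? λ U → ∣ ⊥ {9} ⋎ U ∣ ≟ 3 ×-dec ZeroSum? (⊥ {9} ⋎ U)} _

triple : ℕ → ℕ → ℕ → Subset 18
triple a b c = fromPrefix 18 (map (λ i → (i ≡ᵇ a) ∨ (i ≡ᵇ b) ∨ (i ≡ᵇ c)) (upTo 18))

zeroSumTriples : List (Subset 18)
zeroSumTriples =
  triple 0 1 17 ∷ triple 0 2 16 ∷ triple 0 3 15 ∷ triple 0 4 14 ∷ triple 0 5 13 ∷ triple 0 6 12 ∷
  triple 0 7 11 ∷ triple 0 8 10 ∷ triple 1 2 15 ∷ triple 1 3 14 ∷ triple 1 4 13 ∷ triple 1 5 12 ∷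
  triple 1 6 11 ∷ triple 1 7 10 ∷ triple 1 8 9 ∷ triple 2 3 13 ∷ triple 2 4 12 ∷ triple 2 5 11 ∷
  triple 2 6 10 ∷ triple 2 7 9 ∷ triple 3 4 11 ∷ triple 3 5 10 ∷ triple 3 6 9 ∷ triple 3 7 8 ∷
  triple 3 16 17 ∷ triple 4 5 9 ∷ triple 4 6 8 ∷ triple 4 15 17 ∷ triple 5 6 7 ∷ triple 5 14 17 ∷
  triple 5 15 16 ∷ triple 6 13 17 ∷ triple 6 14 16 ∷ triple 7 12 17 ∷ triple 7 13 16 ∷ triple 7 14 15 ∷
  triple 8 11 17 ∷ triple 8 12 16 ∷ triple 8 13 15 ∷ triple 9 10 17 ∷ triple 9 11 16 ∷ triple 9 12 15 ∷
  triple 9 13 14 ∷ triple 10 11 15 ∷ triple 10 12 14 ∷ triple 11 12 13 ∷ []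

zeroSumTriples-valid : All (λ T → ∣ T ∣ ≡ 3 × ZeroSum T) zeroSumTriples
zeroSumTriples-valid = toWitness {a? = all? (λ T → ∣ T ∣ ≟ 3 ×-dec ZeroSum? T) zeroSumTriples} _

harborthProperty-3-18-10 : HarborthProperty 3 18 10
harborthProperty-3-18-10 S 10≤∣S∣ =
  hasZeroSumSubset-fromCandidates zeroSumTriples-valid (covers-all-large _ S 10≤∣S∣)
  where
  open ThresholdSearch (λ S → Any (_⊆ S) zeroSumTriples) (λ S → any? (_⊆? S) zeroSumTriples)
                       (any-⊆-mono zeroSumTriples) 10

proposition3p16 : IsHarborthConstant 3 18 10
proposition3p16 =
  s≤s z≤n , harborthProperty-3-18-10 ,
  λ t _ property → zeroSumFree⇒size< (oddResidues 9) oddResidues-zeroSumTripleFree property
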